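{- Let $X$ be an acyclic simple graph on $n$ vertices. Then $\mathsf{FS}(X,\text{Star}_n)$ is acyclic, i.e. $g(\mathsf{FS}(X,\text{Star}_n)) = \infty$.
   Context: $\text{Star}_n$ is the graph on $[n]$ with edges $\{i,n\}$, $i\in[n-1]$. $\mathsf{FS}(X,Y)$ has as vertices all bijections $\sigma: V(X)\to V(Y)$, with $\sigma,\sigma'$ adjacent iff there is an edge $\{a,b\}\in E(X)$ with $\{\sigma(a),\sigma(b)\}\in E(Y)$, $\sigma'(a)=\sigma(b)$, $\sigma'(b)=\sigma(a)$ and $\sigma'=\sigma$ elsewhere. $g$ denotes girth. -}

module Defs where

open import Level using (0ℓ)
open import Data.Nat using (ℕ; suc; _≤_; _∸_)
open import Data.Fin using (Fin; fromℕ; inject₁)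
open import Data.Fin.Properties using ()
open import Data.List using (List; length; []; _∷_; lookup)
open import Data.Product using (Σ; _×_; _,_; ∃)
open import Relation.Binary.PropositionalEquality using (_≡_)
open import Relation.Nullary using (¬_)
open import Function.Definitions using (Injective)

record SimpleGraph (n : ℕ) : Set₁ where
  field
    Adj   : Fin n → Fin n → Set
    sym   : ∀ {a b} → Adj a b → Adj b a
    irrefl : ∀ {a} → ¬ Adj a a
open SimpleGraph public

-- Star_n on [n] (here Fin (suc m), n = suc m): edges {i, last} for i ≠ last,
-- where "last" = fromℕ m plays the role of the vertex n.
data StarAdj (m : ℕ) : Fin (suc m) → Fin (suc m) → Set where
  leaf→centre : ∀ i → ¬ i ≡ fromℕ m → StarAdj m i (fromℕ m)
  centre→leaf : ∀ i → ¬ i ≡ fromℕ m → StarAdj m (fromℕ m) i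

record Cycle {V : Set} (_≈_ : V → V → Set) (_~_ : V → V → Set) : Set where
  field
    verts    : List V
    long     : 3 ≤ length verts
    distinct : ∀ i j → ¬ i ≡ j → ¬ (lookup verts i ≈ lookup verts j)
    steps    : ∀ (i j : Fin (length verts)) →
               Data.Fin.toℕ j ≡ suc (Data.Fin.toℕ i) →
               lookup verts i ~ lookup verts j
    closing  : ∀ (i j : Fin (length verts)) →
               Data.Fin.toℕ i ≡ length verts ∸ 1 → Data.Fin.toℕ j ≡ 0 →
               lookup verts i ~ lookup verts j

Acyclic : {V : Set} → (V → V → Set) → (V → V → Set) → Set
Acyclic _≈_ _~_ = ¬ Cycle _≈_ _~_

AcyclicGraph : ∀ {n} → SimpleGraph n → Set
AcyclicGraph X = Acyclic _≡_ (Adj X)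

-- Vertices of FS(X,Y) for X, Y on Fin n: bijections Fin n → Fin n
-- (an injective self-map of a finite set is a bijection).
Bij : ℕ → Set
Bij n = Σ (Fin n → Fin n) (Injective _≡_ _≡_)

_≈B_ : ∀ {n} → Bij n → Bij n → Set
(σ , _) ≈B (τ , _) = ∀ x → σ x ≡ τ x

-- Adjacency in FS(X,Y): some edge {a,b} of X with {σ a, σ b} an edge of Y,
-- and σ' = σ ∘ (a b).
FSAdj : ∀ {n} → (Fin n → Fin n → Set) → (Fin n → Fin n → Set) →
        Bij n → Bij n → Set
FSAdj {n} AX AY (σ , _) (σ' , _) =
  ∃ λ (a : Fin n) → ∃ λ (b : Fin n) →
    AX a b × AY (σ a) (σ b) × σ' a ≡ σ b × σ' b ≡ σ a ×
    (∀ x → ¬ x ≡ a → ¬ x ≡ b → σ' x ≡ σ x)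

-- Every edge of FS(X, Star_n) swaps the centre n with a leaf, so the position σ⁻¹(n)
-- of the centre moves along an edge of X, and σ' = σ ∘ (σ⁻¹(n) σ'⁻¹(n)). If
-- σ₀ → σ₁ → σ₂ returns the centre to its old position, the same transposition is
-- applied twice and σ₀ = σ₂. Hence a cycle in FS(X, Star_n) projects to a closed
-- non-backtracking walk in X, and every closed non-backtracking walk of
-- length at least 3 contains a cycle.
module Submission where

open import Defs renaming (sym to Adj-sym; irrefl to Adj-irrefl)
open import Data.Nat using (ℕ; suc; _+_; _∸_; _≤_; _<_; z≤n; s≤s; z<s; NonZero; >-nonZero)
open import Data.Nat.Properties
  using (≤-refl; ≤-trans; <-≤-trans; ≤-<-trans; <⇒≤; <-cmp; +-suc; +-identityʳ; +-monoʳ-<;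
         m∸n≤m; ∸-monoʳ-<; m<n⇒0<n∸m; m+[n∸m]≡n; m≢1+n+m; 1+n≰n; anyUpTo?)
open import Data.Nat.DivMod using (_mod_; m<n⇒m%n≡m)
open import Data.Nat.Induction using (<-wellFounded)
open import Induction.WellFounded using (Acc; acc)
open import Data.Fin using (Fin; toℕ; fromℕ)
open import Data.Fin.Properties
  using (toℕ-injective; toℕ<n; toℕ-fromℕ<; any?; punchOut-injective; injective⇒≤)
  renaming (_≟_ to _≟ᶠ_)
open import Data.List using (applyUpTo; lookup)
open import Data.List.Properties using (length-applyUpTo; lookup-applyUpTo)
open import Data.Product using (∃; _×_; _,_; proj₁; proj₂)
open import Data.Sum using (_⊎_; inj₁; inj₂)
open import Data.Empty using (⊥-elim)
open import Function using (_∘_)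
open import Function.Definitions using (Injective; StrictlySurjective)
open import Relation.Binary using (DecidableEquality; tri<; tri≈; tri>)
open import Relation.Binary.PropositionalEquality
  using (_≡_; _≢_; _≗_; refl; sym; trans; cong; subst; subst₂)
open import Relation.Nullary using (¬_; yes; no; contradiction)

record IndexedCycle {V : Set} (_≈_ _~_ : V → V → Set) : Set where
  field
    size     : ℕ
    long     : 3 ≤ size
    vertex   : ℕ → V
    distinct : ∀ i j → i < size → j < size → i ≢ j → ¬ vertex i ≈ vertex j
    steps    : ∀ i → suc i < size → vertex i ~ vertex (suc i)
    closing  : vertex (size ∸ 1) ~ vertex 0

module _ {V : Set} {_≈_ _~_ : V → V → Set} where

  fromIndexed : IndexedCycle _≈_ _~_ → Cycle _≈_ _~_
  fromIndexed C = record
    { verts    = verts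
    ; long     = subst (3 ≤_) (sym length-verts) long
    ; distinct = λ i j i≢j →
        distinct (toℕ i) (toℕ j) (bound i) (bound j) (i≢j ∘ toℕ-injective)
        ∘ subst₂ _≈_ (lookup-applyUpTo vertex size i) (lookup-applyUpTo vertex size j)
    ; steps    = λ i j j≡1+i → at i j (subst (λ k → vertex (toℕ i) ~ vertex k) (sym j≡1+i)
                   (steps (toℕ i) (subst (_< size) j≡1+i (bound j))))
    ; closing  = λ i j i≡last j≡0 → at i j (subst₂ (λ k l → vertex k ~ vertex l)
                   (sym (trans i≡last (cong (_∸ 1) length-verts))) (sym j≡0) closing)
    }
    where
    open IndexedCycle C
    verts = applyUpTo vertex size
    length-verts = length-applyUpTo vertex size
    bound : (i : Fin _) → toℕ i < size
    bound i = subst (toℕ i <_) length-verts (toℕ<n i)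
    at : ∀ i j → vertex (toℕ i) ~ vertex (toℕ j) → lookup verts i ~ lookup verts j
    at i j = subst₂ _~_ (sym (lookup-applyUpTo vertex size i)) (sym (lookup-applyUpTo vertex size j))

  toIndexed : Cycle _≈_ _~_ → IndexedCycle _≈_ _~_
  toIndexed C = record
    { size     = L
    ; long     = long
    ; vertex   = λ i → lookup verts (i mod L)
    ; distinct = λ i j i<L j<L i≢j → distinct (i mod L) (j mod L)
        (λ e → i≢j (trans (sym (toℕ-mod i<L)) (trans (cong toℕ e) (toℕ-mod j<L))))
    ; steps    = λ i 1+i<L → steps (i mod L) (suc i mod L)
        (trans (toℕ-mod 1+i<L) (cong suc (sym (toℕ-mod (<⇒≤ 1+i<L)))))
    ; closing  = closing ((L ∸ 1) mod L) (0 mod L) (toℕ-mod (∸-monoʳ-< z<s 0<L)) (toℕ-mod 0<L)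
    }
    where
    open Cycle C
    L = Data.List.length verts
    0<L : 0 < L
    0<L = ≤-trans (s≤s z≤n) long
    instance
      L≢0 : NonZero L
      L≢0 = >-nonZero 0<L
    toℕ-mod : ∀ {i} → i < L → toℕ (i mod L) ≡ i
    toℕ-mod {i} i<L = trans (toℕ-fromℕ< _) (m<n⇒m%n≡m i<L)

module NonBacktrackingWalks {V : Set} (_≟_ : DecidableEquality V)
  (_~_ : V → V → Set) (~-irrefl : ∀ {a} → ¬ a ~ a) where

  Walk : (ℕ → V) → ℕ → Set
  Walk w d = ∀ t → t < d → w t ~ w (suc t)

  NonBacktracking : (ℕ → V) → ℕ → Set
  NonBacktracking w d = ∀ t → suc t < d → w t ≢ w (suc (suc t))

  NBWalk : (ℕ → V) → ℕ → Set
  NBWalk w d = Walk w d × NonBacktracking w d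

  NBWalk-drop : ∀ {w d} i {k} → i + k ≤ d → NBWalk w d → NBWalk (w ∘ (i +_)) k
  NBWalk-drop {w} {d} i {k} i+k≤d (walk , nb) = walk′ , nb′
    where
    inside : ∀ {t} → t < k → i + t < d
    inside t<k = <-≤-trans (+-monoʳ-< i t<k) i+k≤d
    walk′ : Walk (w ∘ (i +_)) k
    walk′ t t<k rewrite +-suc i t = walk (i + t) (inside t<k)
    nb′ : NonBacktracking (w ∘ (i +_)) k
    nb′ t 1+t<k rewrite +-suc i (suc t) | +-suc i t =
      nb (i + t) (subst (_< d) (+-suc i t) (inside 1+t<k))

  Repeat : (ℕ → V) → ℕ → Set
  Repeat w d = ∃ λ j → j < d × ∃ λ i → i < j × w i ≡ w j

  InjectiveBelow : (ℕ → V) → ℕ → Set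
  InjectiveBelow w d = ∀ i j → i < d → j < d → i ≢ j → w i ≢ w j

  repeat-or-injectiveBelow : ∀ (w : ℕ → V) d → Repeat w d ⊎ InjectiveBelow w d
  repeat-or-injectiveBelow w d
    with anyUpTo? (λ j → anyUpTo? (λ i → w i ≟ w j) j) d
  ... | yes r = inj₁ r
  ... | no ¬r = inj₂ injective
    where
    injective : InjectiveBelow w d
    injective i j i<d j<d i≢j e with <-cmp i j
    ... | tri< i<j _ _ = ¬r (j , j<d , i , i<j , e)
    ... | tri≈ _ i≡j _ = i≢j i≡j
    ... | tri> _ _ j<i = ¬r (i , i<d , j , j<i , sym e)

  injectiveClosedWalk⇒cycle : ∀ (w : ℕ → V) d → NBWalk w d → w 0 ≡ w d →
                              InjectiveBelow w d → 0 < d → IndexedCycle _≡_ _~_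
  injectiveClosedWalk⇒cycle w 1 (walk , _) closed _ _ =
    ⊥-elim (~-irrefl (subst (_~ w 1) closed (walk 0 ≤-refl)))
  injectiveClosedWalk⇒cycle w 2 (_ , nb) closed _ _ = ⊥-elim (nb 0 ≤-refl closed)
  injectiveClosedWalk⇒cycle w d@(suc (suc (suc k))) (walk , _) closed injective _ = record
    { size     = d
    ; long     = s≤s (s≤s (s≤s z≤n))
    ; vertex   = w
    ; distinct = injective
    ; steps    = λ t 1+t<d → walk t (<⇒≤ 1+t<d)
    ; closing  = subst (w (suc (suc k)) ~_) (sym closed) (walk (suc (suc k)) ≤-refl)
    }

  closedSegment : ∀ (w : ℕ → V) {i j} → i < j → w i ≡ w j → w (i + 0) ≡ w (i + (j ∸ i))
  closedSegment w {i} i<j e =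
    trans (cong w (+-identityʳ i)) (trans e (cong w (sym (m+[n∸m]≡n (<⇒≤ i<j)))))

  -- Cutting out a repeat w i = w j yields a strictly shorter closed walk.
  closedWalk⇒cycle : ∀ (w : ℕ → V) d → Acc _<_ d → NBWalk w d → w 0 ≡ w d → 0 < d →
                     IndexedCycle _≡_ _~_
  closedWalk⇒cycle w d (acc shorter) nbw closed 0<d with repeat-or-injectiveBelow w d
  ... | inj₂ injective = injectiveClosedWalk⇒cycle w d nbw closed injective 0<d
  ... | inj₁ (j , j<d , i , i<j , e) =
    closedWalk⇒cycle (w ∘ (i +_)) (j ∸ i) (shorter (≤-<-trans (m∸n≤m j i) j<d))
      (NBWalk-drop i (subst (_≤ d) (sym (m+[n∸m]≡n (<⇒≤ i<j))) (<⇒≤ j<d)) nbw)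
      (closedSegment w i<j e) (m<n⇒0<n∸m i<j)

  cyclicNBWalk⇒cycle : ∀ L (w : ℕ → V) → 3 ≤ L →
                       (∀ i → suc i < L → w i ~ w (suc i)) → w (L ∸ 1) ~ w 0 →
                       (∀ i → suc (suc i) < L → w i ≢ w (suc (suc i))) → IndexedCycle _≡_ _~_
  cyclicNBWalk⇒cycle (suc D) w long steps closing nb with repeat-or-injectiveBelow w (suc D)
  ... | inj₂ injective = record
    { size = suc D ; long = long ; vertex = w ; distinct = injective ; steps = steps ; closing = closing }
  ... | inj₁ (j , s≤s j≤D , i , i<j , e) =
    closedWalk⇒cycle (w ∘ (i +_)) (j ∸ i) (<-wellFounded _)
      (NBWalk-drop i (subst (_≤ D) (sym (m+[n∸m]≡n (<⇒≤ i<j))) j≤D)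
        ((λ t t<D → steps t (s≤s t<D)) , (λ t 1+t<D → nb t (s≤s 1+t<D))))
      (closedSegment w i<j e) (m<n⇒0<n∸m i<j)

module _ {A B : Set} where

  Swaps : (A → B) → (A → B) → A → A → Set
  Swaps σ σ′ a b = σ′ a ≡ σ b × σ′ b ≡ σ a × (∀ x → x ≢ a → x ≢ b → σ′ x ≡ σ x)

  Swaps-comm : ∀ {σ σ′ a b} → Swaps σ σ′ a b → Swaps σ σ′ b a
  Swaps-comm (σ′a , σ′b , rest) = σ′b , σ′a , λ x x≢b x≢a → rest x x≢a x≢b

  Swaps-sym : ∀ {σ σ′ a b} → Swaps σ σ′ a b → Swaps σ′ σ a b
  Swaps-sym (σ′a , σ′b , rest) = sym σ′b , sym σ′a , λ x x≢a x≢b → sym (rest x x≢a x≢b)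

  Swaps-functional : DecidableEquality A → ∀ {τ σ σ′ a b} →
                     Swaps τ σ a b → Swaps τ σ′ a b → σ ≗ σ′
  Swaps-functional _≟_ {a = a} {b} (σa , σb , σ-rest) (σ′a , σ′b , σ′-rest) x
    with x ≟ a | x ≟ b
  ... | yes refl | _        = trans σa (sym σ′a)
  ... | no _     | yes refl = trans σb (sym σ′b)
  ... | no x≢a   | no x≢b   = trans (σ-rest x x≢a x≢b) (sym (σ′-rest x x≢a x≢b))

injective⇒strictlySurjective : ∀ {n} {f : Fin n → Fin n} →
                               Injective _≡_ _≡_ f → StrictlySurjective _≡_ f
injective⇒strictlySurjective {suc m} {f} f-inj y with any? (λ x → f x ≟ᶠ y)
... | yes hit = hit
... | no miss = contradiction (injective⇒≤ (f-inj ∘ punchOut-injective (avoids _) (avoids _))) (1+n≰n)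
  where
  avoids : ∀ x → y ≢ f x
  avoids x y≡fx = miss (x , sym y≡fx)

StarAdj-centre : ∀ {m x y} → StarAdj m x y → x ≡ fromℕ m ⊎ y ≡ fromℕ m
StarAdj-centre (leaf→centre _ _) = inj₂ refl
StarAdj-centre (centre→leaf _ _) = inj₁ refl

module FSStar {m : ℕ} (X : SimpleGraph (suc m)) where

  FS : Bij (suc m) → Bij (suc m) → Set
  FS = FSAdj (Adj X) (StarAdj m)

  centrePosition : Bij (suc m) → Fin (suc m)
  centrePosition (σ , σ-inj) = proj₁ (injective⇒strictlySurjective σ-inj (fromℕ m))

  centrePosition-unique : ∀ σ {x} → proj₁ σ x ≡ fromℕ m → x ≡ centrePosition σ
  centrePosition-unique (σ , σ-inj) σx≡c =
    σ-inj (trans σx≡c (sym (proj₂ (injective⇒strictlySurjective σ-inj (fromℕ m)))))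

  moveCentre : ∀ {σ σ′ a b} → Adj X a b → proj₁ σ a ≡ fromℕ m → Swaps (proj₁ σ) (proj₁ σ′) a b →
               Adj X (centrePosition σ) (centrePosition σ′) ×
               Swaps (proj₁ σ) (proj₁ σ′) (centrePosition σ) (centrePosition σ′)
  moveCentre {σ} {σ′} ab σa≡c sw@(_ , σ′b≡σa , _)
    with centrePosition-unique σ σa≡c | centrePosition-unique σ′ (trans σ′b≡σa σa≡c)
  ... | refl | refl = ab , sw

  FS-edge : ∀ {σ σ′} → FS σ σ′ →
            Adj X (centrePosition σ) (centrePosition σ′) ×
            Swaps (proj₁ σ) (proj₁ σ′) (centrePosition σ) (centrePosition σ′)
  FS-edge (a , b , ab , star , sw) with StarAdj-centre star
  ... | inj₁ σa≡c = moveCentre ab σa≡c sw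
  ... | inj₂ σb≡c = moveCentre (Adj-sym X ab) σb≡c (Swaps-comm sw)

  FS-backtrack : ∀ {σ₀ σ₁ σ₂} → FS σ₀ σ₁ → FS σ₁ σ₂ →
                 centrePosition σ₀ ≡ centrePosition σ₂ → σ₀ ≈B σ₂
  FS-backtrack {σ₁ = σ₁} {σ₂} e₀₁ e₁₂ p₀≡p₂ =
    Swaps-functional _≟ᶠ_ (Swaps-sym (proj₂ (FS-edge e₀₁)))
      (Swaps-comm (subst (Swaps (proj₁ σ₁) (proj₁ σ₂) (centrePosition σ₁)) (sym p₀≡p₂)
        (proj₂ (FS-edge e₁₂))))

proposition4p3 : (m : ℕ) (X : SimpleGraph (suc m)) → AcyclicGraph X →
    Acyclic (_≈B_ {suc m}) (FSAdj (Adj X) (StarAdj m))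
proposition4p3 m X acyclic C =
  acyclic (fromIndexed (cyclicNBWalk⇒cycle size (centrePosition ∘ vertex) long
    (λ i 1+i<L → proj₁ (FS-edge (steps i 1+i<L)))
    (proj₁ (FS-edge closing))
    (λ i 2+i<L p≡p → distinct i (suc (suc i)) (<⇒≤ (<⇒≤ 2+i<L)) 2+i<L (m≢1+n+m i)
      (FS-backtrack {vertex i} {vertex (suc i)} (steps i (<⇒≤ 2+i<L)) (steps (suc i) 2+i<L) p≡p))))
  where
  open IndexedCycle (toIndexed C)
  open FSStar X
  open NonBacktrackingWalks _≟ᶠ_ (Adj X) (Adj-irrefl X)
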